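{- Let $\vec\kappa=\langle\kappa_0\le\dots\le\kappa_n\rangle$ be a weakly increasing tuple of cardinals, $0\le k\le n$, let $\langle Y_i:i\le n\rangle$ be a $k$-Fubini partition of $X(\vec\kappa)^-$, and let $\vec f=(f_A)_{A\in[n+1]^{k+2}}$ with $f_A\in\mathcal{C}_A(\vec\kappa)$. For $B\in[n+1]^{k+1}$ define $g_B:\mathcal{D}_B\to\mathbb{Z}_2$ as follows: for $i\le n$ and $\vec x\in\mathcal{D}_B\cap Y_i$, set $g_B(\vec x)=f_{B\cup\{i\}}(\vec x)$ if $i\notin B$ (this is defined since $\mathcal{D}_B\cap Y_i=\mathcal{D}_{B\cup\{i\}}\cap Y_i$ for a $k$-Fubini partition), and $g_B(\vec x)=0$ if $i\in B$. Then $g_B\in\mathcal{C}_B(\vec\kappa)$ for every $B$. Moreover, if $\vec f$ is a cocycle (i.e., $\sum_{i\in A'}f_{A'\setminus\{i\}}=0$ on $\mathcal{D}_{A'}$ for every $A'\in[n+1]^{k+3}$), then $d\vec g=\vec f$, i.e., $\sum_{i\in A}g_{A\setminus\{i\}}=f_A$ on $\mathcal{D}_A$ for every $A\in[n+1]^{k+2}$.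
   Context: For a cardinal $\kappa$, $\alpha(\kappa)=\kappa\sqcup\{\infty\}$ is the one-point compactification of the discrete space $\kappa$. $X(\vec\kappa)=\prod_{i\le n}\alpha(\kappa_i)$ (product topology), $X(\vec\kappa)^-=X(\vec\kappa)\setminus\{(\infty,\dots,\infty)\}$. $[n+1]^m$ is the set of $m$-element subsets of $\{0,\dots,n\}$. For $A\subseteq\{0,\dots,n\}$: $\mathcal{D}_A=\{\vec x\in X(\vec\kappa):x_i\ne\infty\ \forall i\in A\}$ (subspace topology), $\mathcal{C}_A(\vec\kappa)$ the set of continuous maps $\mathcal{D}_A\to\mathbb{Z}_2$ ($\mathbb{Z}_2$ discrete); $F_A=\{\vec x\in X(\vec\kappa):x_i\ne\infty\iff i\in A\}$. For $\vec x\in F_A$ and finite $\mathcal{E}_j\subseteq\kappa_j$ ($j\notin A$), $\mathcal{N}_A(\vec x,\vec{\mathcal{E}})=\{\vec y\in X(\vec\kappa):y_i=x_i\ \forall i\in A,\ y_j=\infty\text{ or }y_j\notin\mathcal{E}_j\ \forall j\notin A\}$. A $k$-Fubini partition of $X(\vec\kappa)^-$ is a partition $\langle Y_i:i\le n\rangle$ of $X(\vec\kappa)^-$ into $n+1$ (possibly empty) sets such that for every $A$ with $|A|\ge k+1$: (1) for every $i\notin A$, $Y_i\cap\mathcal{D}_A$ is clopen in $\mathcal{D}_A$; (2) for every $\vec x\in F_A$ there are finite $\mathcal{E}_j\subseteq\kappa_j$ ($j\notin A$) with $\mathcal{N}_A(\vec x,\vec{\mathcal{E}})\subseteq\bigcup_{i\in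 A}Y_i$. -}

module Defs where

open import Data.Nat using (ℕ; zero; suc; _+_; _≤_)
open import Data.Fin using (Fin; zero; suc)
import Data.Fin as F
open import Data.Fin.Subset using (Subset; _∈_; _∉_; ∣_∣; _∪_; _-_; ⁅_⁆)
open import Data.Vec using (Vec; []; _∷_; lookup)
open import Data.Bool using (Bool; true; false; _∧_; _xor_; if_then_else_)
open import Data.Maybe using (Maybe; just; nothing)
open import Data.List using (List)
open import Data.List.Membership.Propositional using () renaming (_∉_ to _∉ₗ_)
open import Data.Product using (Σ; _×_; ∃)
open import Data.Unit using (⊤)
open import Data.Empty using (⊥)
open import Relation.Binary.PropositionalEquality using (_≡_)
open import Function.Bundles using (_↣_)

-- Coordinates: κ : Fin (suc n) → Set (the cardinals κ₀,…,κₙ as sets).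
-- α(κ) = Maybe κ, with  nothing = ∞.
-- X(κ) = ∏_{i ≤ n} α(κ i).
X : ∀ {n} → (Fin (suc n) → Set) → Set
X {n} κ = (i : Fin (suc n)) → Maybe (κ i)

IsFin : ∀ {A : Set} → Maybe A → Set
IsFin (just _) = ⊤
IsFin nothing  = ⊥

InD : ∀ {n} {κ : Fin (suc n) → Set} → Subset (suc n) → X κ → Set
InD A x = ∀ i → i ∈ A → IsFin (x i)

InF : ∀ {n} {κ : Fin (suc n) → Set} → Subset (suc n) → X κ → Set
InF A x = ∀ i → (i ∈ A → IsFin (x i)) × (IsFin (x i) → i ∈ A)

AvoidsOrInf : ∀ {A : Set} → List A → Maybe A → Set
AvoidsOrInf E nothing  = ⊤
AvoidsOrInf E (just b) = b ∉ₗ E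

InN : ∀ {n} {κ : Fin (suc n) → Set} → Subset (suc n) → X κ →
      ((j : Fin (suc n)) → List (κ j)) → X κ → Set
InN A x E y = ∀ j → (j ∈ A → y j ≡ x j) × (j ∉ A → AvoidsOrInf (E j) (y j))

-- Basic neighbourhood of an arbitrary point x of X(κ) in the product
-- topology: coordinates j with x_j ∈ κ_j are fixed, coordinates j with
-- x_j = ∞ range over α(κ_j) ∖ ℰ_j for a finite ℰ_j.
BasicCoord : ∀ {A : Set} → Maybe A → List A → Maybe A → Set
BasicCoord (just a) E y = y ≡ just a
BasicCoord nothing  E y = AvoidsOrInf E y

InBasic : ∀ {n} {κ : Fin (suc n) → Set} → X κ →
          ((j : Fin (suc n)) → List (κ j)) → X κ → Set
InBasic x E y = ∀ j → BasicCoord (x j) (E j) (y j)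

OpenIn : ∀ {n} {κ : Fin (suc n) → Set} → Subset (suc n) → (X κ → Set) → Set
OpenIn {n} {κ} A P =
  ∀ x → InD A x → P x →
    Σ ((j : Fin (suc n)) → List (κ j)) λ E →
      ∀ y → InD A y → InBasic x E y → P y

ClopenIn : ∀ {n} {κ : Fin (suc n) → Set} → Subset (suc n) → (X κ → Set) → Set
ClopenIn A P = OpenIn A P × OpenIn A (λ x → P x → ⊥)

-- A map 𝒟_A → ℤ₂ is represented by a function f : X κ → Bool whose values
-- off 𝒟_A are irrelevant.  f ∈ 𝒞_A(κ): continuous on 𝒟_A into the discrete
-- space ℤ₂ = Bool, i.e. the preimage of every point is open in 𝒟_A.
Continuous : ∀ {n} {κ : Fin (suc n) → Set} → Subset (suc n) → (X κ → Bool) → Set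
Continuous A f = ∀ b → OpenIn A (λ x → f x ≡ b)

-- The partition ⟨Y_i : i ≤ n⟩ of X(κ)⁻ is given by its labelling function
-- Y : X κ → Fin (suc n)  (x ∈ Y_i iff Y x ≡ i); the value at (∞,…,∞) is
-- irrelevant (it is never referenced below).
IsFubini : ∀ {n} {κ : Fin (suc n) → Set} → ℕ → (X κ → Fin (suc n)) → Set
IsFubini {n} {κ} k Y =
  ∀ (A : Subset (suc n)) → suc k ≤ ∣ A ∣ →
    (∀ i → i ∉ A → ClopenIn A (λ x → Y x ≡ i))
    × (∀ x → InF A x →
         Σ ((j : Fin (suc n)) → List (κ j)) λ E →
           ∀ y → InN A x E y → Y y ∈ A)

WeaklyIncreasing : ∀ {n} → (Fin (suc n) → Set) → Set
WeaklyIncreasing {n} κ = ∀ (i j : Fin (suc n)) → i F.≤ j → κ i ↣ κ j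

sumOver : ∀ {m} → Subset m → (Fin m → Bool) → Bool
sumOver []      h = false
sumOver (b ∷ A) h = (b ∧ h zero) xor sumOver A (λ i → h (suc i))

gMap : ∀ {n} {κ : Fin (suc n) → Set} → (X κ → Fin (suc n)) →
       (Subset (suc n) → X κ → Bool) → Subset (suc n) → X κ → Bool
gMap Y f B x = if lookup B (Y x) then false else f (B ∪ ⁅ Y x ⁆) x

{-# OPTIONS --safe #-}
module Submission where

-- Fix B with |B| ≥ k + 1 and x ∈ 𝒟_B, and let j = Y(x). Condition (2) of the Fubini partition,
-- at the set of finite coordinates of x (which contains B), forces x_j ≠ ∞. If j ∈ B, then x lies
-- outside the finitely many sets Y_i ∩ 𝒟_B, i ∉ B, which are closed by condition (1), so near x
-- the value of g_B stays 0. If j ∉ B, then near x the value of Y stays j (Y_j ∩ 𝒟_B is open) and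
-- x_j stays finite, so g_B agrees with the continuous f_{B ∪ {j}} there.
-- Now let x ∈ 𝒟_A, j = Y(x). If j ∈ A, the only nonzero term of Σ_{i ∈ A} g_{A∖i}(x) is
-- g_{A∖j}(x) = f_A(x). If j ∉ A, then g_{A∖i}(x) = f_{(A ∪ {j})∖i}(x) for every i ∈ A, and the
-- cocycle identity on A ∪ {j} says precisely that these terms sum to f_A(x).

open import Defs
open import Data.Nat using (ℕ; zero; suc; _≤_)
open import Data.Nat.Properties using (≤-trans; ≤-reflexive; n≤1+n)
open import Data.Fin using (Fin; zero; suc)
open import Data.Fin.Properties using (suc-injective)
open import Data.Fin.Subset using (Subset; ∣_∣; _-_; _∈_; _∉_; _⊆_; _∪_; ⁅_⁆)
open import Data.Fin.Subset.Properties
  using (_∈?_; ∪-identityʳ; p─⊥≡p; p─q⊆p; x∈p∧x≢y⇒x∈p-y; x∈p∪q⁻; x∈⁅y⁆⇒x≡y; p⊆q⇒∣p∣≤∣q∣)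
open import Data.Bool using (Bool; true; false; _∧_; _∨_; _xor_)
open import Data.Bool.Properties using (∨-identityʳ; xor-identityʳ; xor-∧-commutativeRing)
open import Data.List using (List; []; _++_)
import Data.List.Relation.Binary.Subset.Propositional as List
open import Data.List.Relation.Binary.Subset.Propositional.Properties using (xs⊆xs++ys; xs⊆ys++xs)
open import Data.Maybe using (Maybe; just; nothing; is-just)
open import Data.Product using (Σ; _×_; _,_; proj₁; proj₂)
open import Data.Sum using (inj₁; inj₂)
open import Data.Unit using (tt)
open import Data.Vec using ([]; _∷_; lookup; tabulate)
open import Data.Vec.Base using (here; there)
open import Data.Vec.Properties using ([]=⇒lookup; lookup⇒[]=; lookup∘tabulate)
open import Function using (_∘_)
open import Relation.Binary.PropositionalEquality
  using (_≡_; _≢_; refl; sym; trans; cong; cong₂; subst; ≢-sym; module ≡-Reasoning)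
open import Relation.Nullary using (¬_; Dec; yes; no; contradiction)
open import Relation.Nullary.Decidable using (decidable-stable)
open import Algebra.Bundles using (CommutativeRing)

open CommutativeRing xor-∧-commutativeRing using (+-group; +-commutativeSemigroup)
open import Algebra.Properties.Group +-group using (inverseʳ-unique)
open import Algebra.Properties.CommutativeSemigroup +-commutativeSemigroup using (x∙yz≈y∙xz)

x∈p-y⇒x≢y : ∀ {n} {p : Subset n} {x y : Fin n} → x ∈ p - y → x ≢ y
x∈p-y⇒x≢y {p = _ ∷ _} {zero} {zero} ()
x∈p-y⇒x≢y {x = zero}  {suc y} _ ()
x∈p-y⇒x≢y {x = suc x} {zero}  _ ()
x∈p-y⇒x≢y {p = _ ∷ _} {suc x} {suc y} (there x∈p-y) = x∈p-y⇒x≢y x∈p-y ∘ suc-injective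

[p-x]∪⁅x⁆≡p : ∀ {n} {p : Subset n} {x} → x ∈ p → (p - x) ∪ ⁅ x ⁆ ≡ p
[p-x]∪⁅x⁆≡p here = cong (true ∷_) (trans (∪-identityʳ _) (p─⊥≡p _))
[p-x]∪⁅x⁆≡p {p = s ∷ _} (there x∈p) = cong₂ _∷_ (∨-identityʳ s) ([p-x]∪⁅x⁆≡p x∈p)

[p∪⁅x⁆]-x≡p : ∀ {n} {p : Subset n} {x} → x ∉ p → (p ∪ ⁅ x ⁆) - x ≡ p
[p∪⁅x⁆]-x≡p {p = true  ∷ _} {zero}  x∉p = contradiction here x∉p
[p∪⁅x⁆]-x≡p {p = false ∷ p} {zero}  _   = cong (false ∷_) (trans (p─⊥≡p _) (∪-identityʳ p))
[p∪⁅x⁆]-x≡p {p = s     ∷ _} {suc x} x∉p = cong₂ _∷_ (∨-identityʳ s) ([p∪⁅x⁆]-x≡p (x∉p ∘ there))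

[p∪⁅y⁆]-x≡[p-x]∪⁅y⁆ : ∀ {n} {p : Subset n} {x y} → x ≢ y → (p ∪ ⁅ y ⁆) - x ≡ (p - x) ∪ ⁅ y ⁆
[p∪⁅y⁆]-x≡[p-x]∪⁅y⁆ {x = zero}  {zero}  x≢y = contradiction refl x≢y
[p∪⁅y⁆]-x≡[p-x]∪⁅y⁆ {p = _ ∷ p} {zero} {suc y} _ =
  cong (false ∷_) (trans (p─⊥≡p _) (cong (_∪ ⁅ y ⁆) (sym (p─⊥≡p p))))
[p∪⁅y⁆]-x≡[p-x]∪⁅y⁆ {p = s ∷ p} {suc x} {zero} _ =
  cong ((s ∨ true) ∷_) (trans (cong (_- x) (∪-identityʳ p)) (sym (∪-identityʳ _)))
[p∪⁅y⁆]-x≡[p-x]∪⁅y⁆ {p = s ∷ _} {suc x} {suc y} x≢y =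
  cong ((s ∨ false) ∷_) ([p∪⁅y⁆]-x≡[p-x]∪⁅y⁆ (x≢y ∘ cong suc))

∣p∪⁅x⁆∣≡1+∣p∣ : ∀ {n} {p : Subset n} {x} → x ∉ p → ∣ p ∪ ⁅ x ⁆ ∣ ≡ suc ∣ p ∣
∣p∪⁅x⁆∣≡1+∣p∣ {p = true  ∷ _} {zero}  x∉p = contradiction here x∉p
∣p∪⁅x⁆∣≡1+∣p∣ {p = false ∷ p} {zero}  _   = cong (suc ∘ ∣_∣) (∪-identityʳ p)
∣p∪⁅x⁆∣≡1+∣p∣ {p = true  ∷ _} {suc x} x∉p = cong suc (∣p∪⁅x⁆∣≡1+∣p∣ (x∉p ∘ there))
∣p∪⁅x⁆∣≡1+∣p∣ {p = false ∷ _} {suc x} x∉p = ∣p∪⁅x⁆∣≡1+∣p∣ (x∉p ∘ there)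

sumOver-cong : ∀ {n} {p : Subset n} {h h′ : Fin n → Bool} →
               (∀ {i} → i ∈ p → h i ≡ h′ i) → sumOver p h ≡ sumOver p h′
sumOver-cong {p = []}        _  = refl
sumOver-cong {p = true  ∷ _} eq = cong₂ _xor_ (eq here) (sumOver-cong (eq ∘ there))
sumOver-cong {p = false ∷ _} eq = sumOver-cong (eq ∘ there)

sumOver-false : ∀ {n} {p : Subset n} {h : Fin n → Bool} →
                (∀ {i} → i ∈ p → h i ≡ false) → sumOver p h ≡ false
sumOver-false {p = []}        _  = refl
sumOver-false {p = true  ∷ _} eq = cong₂ _xor_ (eq here) (sumOver-false (eq ∘ there))
sumOver-false {p = false ∷ _} eq = sumOver-false (eq ∘ there)

sumOver-∪⁅⁆ : ∀ {n} {p : Subset n} {x} (h : Fin n → Bool) → x ∉ p →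
              sumOver (p ∪ ⁅ x ⁆) h ≡ h x xor sumOver p h
sumOver-∪⁅⁆ {p = true  ∷ _} {zero} h x∉p = contradiction here x∉p
sumOver-∪⁅⁆ {p = false ∷ p} {zero} h _   =
  cong (λ q → h zero xor sumOver q (h ∘ suc)) (∪-identityʳ p)
sumOver-∪⁅⁆ {p = s ∷ p} {suc x} h x∉p = begin
  ((s ∨ false) ∧ h zero) xor sumOver (p ∪ ⁅ x ⁆) (h ∘ suc)
    ≡⟨ cong₂ _xor_ (cong (_∧ h zero) (∨-identityʳ s)) (sumOver-∪⁅⁆ (h ∘ suc) (x∉p ∘ there)) ⟩
  (s ∧ h zero) xor (h (suc x) xor sumOver p (h ∘ suc))
    ≡⟨ x∙yz≈y∙xz (s ∧ h zero) (h (suc x)) _ ⟩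
  h (suc x) xor sumOver (s ∷ p) h ∎
  where open ≡-Reasoning

sumOver-remove : ∀ {n} {p : Subset n} {x} (h : Fin n → Bool) → x ∈ p →
                 sumOver p h ≡ h x xor sumOver (p - x) h
sumOver-remove {p = p} {x} h x∈p = begin
  sumOver p h                  ≡⟨ cong (λ q → sumOver q h) ([p-x]∪⁅x⁆≡p x∈p) ⟨
  sumOver ((p - x) ∪ ⁅ x ⁆) h  ≡⟨ sumOver-∪⁅⁆ {p = p - x} h (λ x∈p-x → x∈p-y⇒x≢y x∈p-x refl) ⟩
  h x xor sumOver (p - x) h    ∎
  where open ≡-Reasoning

basicCoord-antitone : ∀ {A : Set} (a : Maybe A) {E₁ E₂ y} → E₁ List.⊆ E₂ →
                      BasicCoord a E₂ y → BasicCoord a E₁ y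
basicCoord-antitone (just _) _ y≡a = y≡a
basicCoord-antitone nothing {y = nothing} _ _ = tt
basicCoord-antitone nothing {y = just _} E₁⊆E₂ b∉E₂ = b∉E₂ ∘ E₁⊆E₂

basicCoord-IsFin : ∀ {A : Set} {a : Maybe A} {E y} → IsFin a → BasicCoord a E y → IsFin y
basicCoord-IsFin {a = just _} _ refl = tt

¬IsFin⇒AvoidsOrInf : ∀ {A : Set} {a : Maybe A} {E} → ¬ IsFin a → AvoidsOrInf E a
¬IsFin⇒AvoidsOrInf {a = just _}  a-inf = contradiction tt a-inf
¬IsFin⇒AvoidsOrInf {a = nothing} _     = tt

is-just⇒IsFin : ∀ {A : Set} (a : Maybe A) → is-just a ≡ true → IsFin a
is-just⇒IsFin (just _) _ = tt

IsFin⇒is-just : ∀ {A : Set} (a : Maybe A) → IsFin a → is-just a ≡ true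
IsFin⇒is-just (just _) _ = refl

module _ {n : ℕ} {κ : Fin (suc n) → Set} where

  HoldsNear : Subset (suc n) → X κ → (X κ → Set) → Set
  HoldsNear A x P = Σ ((j : Fin (suc n)) → List (κ j)) λ E → ∀ y → InD A y → InBasic x E y → P y

  module Near (A : Subset (suc n)) (x : X κ) where

    holdsNear-always : {P : X κ → Set} → (∀ {y} → P y) → HoldsNear A x P
    holdsNear-always p = (λ _ → []) , λ _ _ _ → p

    holdsNear-map : {P Q : X κ → Set} → (∀ {y} → P y → Q y) → HoldsNear A x P → HoldsNear A x Q
    holdsNear-map P⇒Q (E , near) = E , λ y y∈D y∈N → P⇒Q (near y y∈D y∈N)

    holdsNear-× : {P Q : X κ → Set} → HoldsNear A x P → HoldsNear A x Q →
                  HoldsNear A x (λ y → P y × Q y)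
    holdsNear-× (E₁ , near₁) (E₂ , near₂) = (λ j → E₁ j ++ E₂ j) , λ y y∈D y∈N →
      near₁ y y∈D (λ j → basicCoord-antitone (x j) (xs⊆xs++ys (E₁ j) (E₂ j)) (y∈N j)) ,
      near₂ y y∈D (λ j → basicCoord-antitone (x j) (xs⊆ys++xs (E₂ j) (E₁ j)) (y∈N j))

    holdsNear-∀ : ∀ {m} {P : Fin m → X κ → Set} → (∀ t → HoldsNear A x (P t)) →
                  HoldsNear A x (λ y → ∀ t → P t y)
    holdsNear-∀ {zero}  _    = holdsNear-always (λ ())
    holdsNear-∀ {suc m} near = holdsNear-map (λ { (p₀ , _) zero → p₀ ; (_ , p) (suc t) → p t })
                                             (holdsNear-× (near zero) (holdsNear-∀ (near ∘ suc)))

  InD-∪⁅⁆ : ∀ {B : Subset (suc n)} {x : X κ} {j} → InD B x → IsFin (x j) → InD (B ∪ ⁅ j ⁆) x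
  InD-∪⁅⁆ {B} {x} {j} x∈D xⱼ-fin i i∈B∪j with x∈p∪q⁻ B ⁅ j ⁆ i∈B∪j
  ... | inj₁ i∈B   = x∈D i i∈B
  ... | inj₂ i∈⁅j⁆ = subst (IsFin ∘ x) (sym (x∈⁅y⁆⇒x≡y j i∈⁅j⁆)) xⱼ-fin

  -- A basic neighbourhood of x fixes every finite coordinate of x, so it keeps y_j finite.
  holdsNear-∪⁅⁆ : ∀ {B : Subset (suc n)} {x : X κ} {j} {P : X κ → Set} → IsFin (x j) →
                  HoldsNear (B ∪ ⁅ j ⁆) x P → HoldsNear B x P
  holdsNear-∪⁅⁆ {x = x} {j} xⱼ-fin (E , near) = E , λ y y∈D y∈N →
    near y (InD-∪⁅⁆ y∈D (basicCoord-IsFin {a = x j} xⱼ-fin (y∈N j))) y∈N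

  support : X κ → Subset (suc n)
  support x = tabulate (λ i → is-just (x i))

  InF-support : ∀ x → InF (support x) x
  InF-support x i = from , to
    where
    lookup-support : lookup (support x) i ≡ is-just (x i)
    lookup-support = lookup∘tabulate (λ i → is-just (x i)) i
    from : i ∈ support x → IsFin (x i)
    from i∈ = is-just⇒IsFin (x i) (trans (sym lookup-support) ([]=⇒lookup i∈))
    to : IsFin (x i) → i ∈ support x
    to xᵢ-fin = lookup⇒[]= i _ (trans lookup-support (IsFin⇒is-just (x i) xᵢ-fin))

  InN-self : ∀ {A : Subset (suc n)} {x : X κ} {E} → InF A x → InN A x E x
  InN-self x∈F j = (λ _ → refl) , λ j∉A → ¬IsFin⇒AvoidsOrInf (j∉A ∘ proj₂ (x∈F j))

  module _ {k : ℕ} {Y : X κ → Fin (suc n)} (fubini : IsFubini k Y)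
           {B : Subset (suc n)} (k<∣B∣ : suc k ≤ ∣ B ∣) {x : X κ} (x∈D : InD B x) where

    open Near B x

    private
      part-clopen : ∀ j → j ∉ B → ClopenIn B (λ y → Y y ≡ j)
      part-clopen = proj₁ (fubini B k<∣B∣)

    finite-at-part : IsFin (x (Y x))
    finite-at-part = proj₁ (InF-support x (Y x)) Yx∈support
      where
      B⊆support : B ⊆ support x
      B⊆support {i} i∈B = proj₂ (InF-support x i) (x∈D i i∈B)
      k<∣support∣ : suc k ≤ ∣ support x ∣
      k<∣support∣ = ≤-trans k<∣B∣ (p⊆q⇒∣p∣≤∣q∣ B⊆support)
      Yx∈support : Y x ∈ support x
      Yx∈support = proj₂ (proj₂ (fubini (support x) k<∣support∣) x (InF-support x))
                         x (InN-self (InF-support x))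

    near-same-part : Y x ∉ B → HoldsNear B x (λ y → Y y ≡ Y x)
    near-same-part Yx∉B = proj₁ (part-clopen (Y x) Yx∉B) x x∈D refl

    near-part-∈ : Y x ∈ B → HoldsNear B x (λ y → Y y ∈ B)
    near-part-∈ Yx∈B = holdsNear-map
      (λ {y} avoids → decidable-stable (Y y ∈? B) (λ Yy∉B → avoids (Y y) Yy∉B refl))
      (holdsNear-∀ avoid)
      where
      avoid : ∀ j → HoldsNear B x (λ y → j ∉ B → Y y ≢ j)
      avoid j with j ∈? B
      ... | yes j∈B = holdsNear-always (λ j∉B → contradiction j∈B j∉B)
      ... | no  j∉B = holdsNear-map (λ Yy≢j _ → Yy≢j) (proj₂ (part-clopen j j∉B) x x∈D
                        (λ Yx≡j → j∉B (subst (_∈ B) Yx≡j Yx∈B)))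

  IsCocycle : ℕ → (Subset (suc n) → X κ → Bool) → Set
  IsCocycle k f = ∀ A′ → ∣ A′ ∣ ≡ suc (suc (suc k)) → ∀ x → InD A′ x →
                  sumOver A′ (λ i → f (A′ - i) x) ≡ false

  module _ (Y : X κ → Fin (suc n)) (f : Subset (suc n) → X κ → Bool) where

    gMap-∈ : ∀ {B x} → Y x ∈ B → gMap Y f B x ≡ false
    gMap-∈ Yx∈B rewrite []=⇒lookup Yx∈B = refl

    gMap-∉ : ∀ {B x j} → Y x ≡ j → j ∉ B → gMap Y f B x ≡ f (B ∪ ⁅ j ⁆) x
    gMap-∉ {B} {x} refl Yx∉B with lookup B (Y x) in eq
    ... | true  = contradiction (lookup⇒[]= (Y x) B eq) Yx∉B
    ... | false = refl

    sumOver-gMap-part∈ : ∀ {A x} → Y x ∈ A → sumOver A (λ i → gMap Y f (A - i) x) ≡ f A x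
    sumOver-gMap-part∈ {A} {x} j∈A = begin
      sumOver A g                      ≡⟨ sumOver-remove g j∈A ⟩
      g j xor sumOver (A - j) g        ≡⟨ cong₂ _xor_ (gMap-∉ refl j∉A-j)
                                                      (sumOver-false g-vanishes) ⟩
      f ((A - j) ∪ ⁅ j ⁆) x xor false  ≡⟨ xor-identityʳ _ ⟩
      f ((A - j) ∪ ⁅ j ⁆) x            ≡⟨ cong (λ S → f S x) ([p-x]∪⁅x⁆≡p j∈A) ⟩
      f A x                            ∎
      where
      open ≡-Reasoning
      j : Fin (suc n)
      j = Y x
      g : Fin (suc n) → Bool
      g i = gMap Y f (A - i) x
      j∉A-j : j ∉ A - j
      j∉A-j j∈A-j = x∈p-y⇒x≢y j∈A-j refl
      g-vanishes : ∀ {i} → i ∈ A - j → g i ≡ false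
      g-vanishes i∈A-j = gMap-∈ (x∈p∧x≢y⇒x∈p-y j∈A (≢-sym (x∈p-y⇒x≢y i∈A-j)))

    module _ {k : ℕ} (fubini : IsFubini k Y) where

      gMap-continuous : (∀ A → ∣ A ∣ ≡ suc (suc k) → Continuous A (f A)) →
                        ∀ B → ∣ B ∣ ≡ suc k → Continuous B (gMap Y f B)
      gMap-continuous f-cont B ∣B∣≡1+k b x x∈D gx≡b = by-part (Y x ∈? B)
        where
        open Near B x
        k<∣B∣ : suc k ≤ ∣ B ∣
        k<∣B∣ = ≤-reflexive (sym ∣B∣≡1+k)

        by-part : Dec (Y x ∈ B) → HoldsNear B x (λ y → gMap Y f B y ≡ b)
        by-part (yes Yx∈B) =
          holdsNear-map (λ Yy∈B → trans (gMap-∈ Yy∈B) (trans (sym (gMap-∈ Yx∈B)) gx≡b))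
                        (near-part-∈ fubini k<∣B∣ x∈D Yx∈B)
        by-part (no Yx∉B) =
          holdsNear-map (λ (Yy≡Yx , fy≡b) → trans (gMap-∉ Yy≡Yx Yx∉B) fy≡b)
                        (holdsNear-× (near-same-part fubini k<∣B∣ x∈D Yx∉B) near-f)
          where
          xⱼ-fin : IsFin (x (Y x))
          xⱼ-fin = finite-at-part fubini k<∣B∣ x∈D
          near-f : HoldsNear B x (λ y → f (B ∪ ⁅ Y x ⁆) y ≡ b)
          near-f = holdsNear-∪⁅⁆ {x = x} xⱼ-fin
            (f-cont (B ∪ ⁅ Y x ⁆) (trans (∣p∪⁅x⁆∣≡1+∣p∣ Yx∉B) (cong suc ∣B∣≡1+k)) b x
                    (InD-∪⁅⁆ x∈D xⱼ-fin) (trans (sym (gMap-∉ refl Yx∉B)) gx≡b))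

      sumOver-gMap-part∉ : IsCocycle k f → ∀ {A x} → ∣ A ∣ ≡ suc (suc k) → InD A x → Y x ∉ A →
                           sumOver A (λ i → gMap Y f (A - i) x) ≡ f A x
      sumOver-gMap-part∉ cocycle {A} {x} ∣A∣≡2+k x∈D j∉A = inverseʳ-unique _ _ (begin
        f A x xor sumOver A g         ≡⟨ cong (f A x xor_) (sumOver-cong g≡h) ⟩
        f A x xor sumOver A h         ≡⟨ cong (λ S → f S x xor sumOver A h) ([p∪⁅x⁆]-x≡p j∉A) ⟨
        f (A′ - j) x xor sumOver A h  ≡⟨ sumOver-∪⁅⁆ h j∉A ⟨
        sumOver A′ h                  ≡⟨ cocycle A′ ∣A′∣≡3+k x (InD-∪⁅⁆ x∈D xⱼ-fin) ⟩
        false                         ∎)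
        where
        open ≡-Reasoning
        j : Fin (suc n)
        j = Y x
        A′ : Subset (suc n)
        A′ = A ∪ ⁅ j ⁆
        g h : Fin (suc n) → Bool
        g i = gMap Y f (A - i) x
        h i = f (A′ - i) x
        ∣A′∣≡3+k : ∣ A′ ∣ ≡ suc (suc (suc k))
        ∣A′∣≡3+k = trans (∣p∪⁅x⁆∣≡1+∣p∣ j∉A) (cong suc ∣A∣≡2+k)
        xⱼ-fin : IsFin (x j)
        xⱼ-fin = finite-at-part fubini (subst (suc k ≤_) (sym ∣A∣≡2+k) (n≤1+n (suc k))) x∈D
        g≡h : ∀ {i} → i ∈ A → g i ≡ h i
        g≡h {i} i∈A = trans (gMap-∉ refl (j∉A ∘ p─q⊆p A ⁅ i ⁆))
                            (cong (λ S → f S x) (sym ([p∪⁅y⁆]-x≡[p-x]∪⁅y⁆ i≢j)))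
          where
          i≢j : i ≢ j
          i≢j i≡j = j∉A (subst (_∈ A) i≡j i∈A)

      gMap-coboundary : IsCocycle k f → ∀ A → ∣ A ∣ ≡ suc (suc k) → ∀ x → InD A x →
                        sumOver A (λ i → gMap Y f (A - i) x) ≡ f A x
      gMap-coboundary cocycle A ∣A∣≡2+k x x∈D with Y x ∈? A
      ... | yes Yx∈A = sumOver-gMap-part∈ Yx∈A
      ... | no  Yx∉A = sumOver-gMap-part∉ cocycle ∣A∣≡2+k x∈D Yx∉A

proposition4p5 : (n : ℕ) (κ : Fin (suc n) → Set) → WeaklyIncreasing κ →
    (k : ℕ) → k ≤ n →
    (Y : X κ → Fin (suc n)) → IsFubini k Y →
    (f : Subset (suc n) → X κ → Bool) →
    (∀ A → ∣ A ∣ ≡ suc (suc k) → Continuous A (f A)) →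
    (∀ B → ∣ B ∣ ≡ suc k → Continuous B (gMap Y f B))
    × ((∀ A′ → ∣ A′ ∣ ≡ suc (suc (suc k)) → ∀ x → InD A′ x →
          sumOver A′ (λ i → f (A′ - i) x) ≡ false) →
       ∀ A → ∣ A ∣ ≡ suc (suc k) → ∀ x → InD A x →
          sumOver A (λ i → gMap Y f (A - i) x) ≡ f A x)
proposition4p5 n κ _ k _ Y fubini f f-cont =
  gMap-continuous Y f fubini f-cont , gMap-coboundary Y f fubini
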